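{- Let $G=(V,E)$ be a finite connected graph on $n$ vertices whose resistance curvature satisfies $K\le\kappa_i\le K_2$ for all $i$, where $K>0$. Then the Kirchhoff index satisfies $$\frac{n}{2K_2}\leq \operatorname{Kf}(G)=\sum_{i<j}\Omega_{ij}\leq \frac{n}{2K}.$$
   Context: Throughout, $G=(V,E)$ is a finite, simple, connected graph with vertices $v_1,\dots,v_n$, $n\ge 2$. Let $D$ be the diagonal degree matrix, $A$ the adjacency matrix, and $\Gamma = D-A+\frac1n J$, where $J$ is the $n\times n$ all-ones matrix. The resistance matrix $\Omega$ is defined by $\Omega_{ij}=(\Gamma^{ -1})_{ii}+(\Gamma^{ -1})_{jj}-2(\Gamma^{ -1})_{ij}$; it is invertible. The resistance curvature is the unique vector $\kappa\in\mathbb{R}^n$ with $\Omega\kappa=\mathbf{1}$, $\mathbf 1=(1,\dots,1)$.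
   Formalization: The bounds K and K₂ on the resistance curvature are rational numbers. -}

module Defs where

open import Data.Nat using (ℕ; zero; suc)
open import Data.Fin using (Fin; zero; suc; toℕ; _≟_)
open import Data.Bool using (Bool; true; false; if_then_else_)
open import Data.Rational using (ℚ; 0ℚ; 1ℚ; _+_; _*_; _-_; _÷_; _/_; ≢-nonZero)
import Data.Rational as Q
open import Data.Rational.Properties using () renaming (_≟_ to _≟ℚ_)
open import Data.Integer using (+_)
open import Relation.Nullary using (yes; no; ¬_)
open import Relation.Binary.PropositionalEquality using (_≡_)
import Data.Nat as N

record SimpleGraph (n : ℕ) : Set where
  field
    adj     : Fin n → Fin n → Bool
    adj-sym : ∀ i j → adj i j ≡ adj j i
    loopless : ∀ i → adj i i ≡ false
open SimpleGraph public

data Reachable {n : ℕ} (G : SimpleGraph n) : Fin n → Fin n → Set where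
  here : ∀ {i} → Reachable G i i
  step : ∀ {i j k} → adj G i j ≡ true → Reachable G j k → Reachable G i k

Connected : ∀ {n} → SimpleGraph n → Set
Connected {n} G = ∀ (i j : Fin n) → Reachable G i j

∑ : ∀ {n} → (Fin n → ℚ) → ℚ
∑ {zero} f = 0ℚ
∑ {suc n} f = f zero + ∑ (λ i → f (suc i))

Matrix : ℕ → Set
Matrix n = Fin n → Fin n → ℚ

_·_ : ∀ {n} → Matrix n → Matrix n → Matrix n
(A · B) i k = ∑ (λ j → A i j * B j k)

δ : ∀ {n} → Fin n → Fin n → ℚ
δ i j with i ≟ j
... | yes _ = 1ℚ
... | no _ = 0ℚ

I : ∀ {n} → Matrix n
I = δ

_≡ᴹ_ : ∀ {n} → Matrix n → Matrix n → Set
A ≡ᴹ B = ∀ i j → A i j ≡ B i j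

b2q : Bool → ℚ
b2q true = 1ℚ
b2q false = 0ℚ

Adj : ∀ {n} → SimpleGraph n → Matrix n
Adj G i j = b2q (adj G i j)

deg : ∀ {n} → SimpleGraph n → Fin n → ℚ
deg G i = ∑ (λ j → Adj G i j)

Deg : ∀ {n} → SimpleGraph n → Matrix n
Deg G i j = δ i j * deg G i

inv : ℕ → ℚ
inv zero = 0ℚ
inv (suc k) = + 1 / suc k

Γ : ∀ {n} → SimpleGraph n → Matrix n
Γ {n} G i j = (Deg G i j - Adj G i j) + inv n

-- Resistance matrix built from (the) inverse M of Γ
Ω : ∀ {n} → Matrix n → Matrix n
Ω M i j = (M i i + M j j) - (+ 2 / 1) * M i j

Kf : ∀ {n} → Matrix n → ℚ
Kf {n} Om = ∑ (λ i → ∑ (λ j → if toℕ i N.<ᵇ toℕ j then Om i j else 0ℚ))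

-- total division (q ÷ 0 := 0; only used with nonzero divisor)
_÷'_ : ℚ → ℚ → ℚ
p ÷' q with q ≟ℚ 0ℚ
... | yes _ = 0ℚ
... | no q≢0 = _÷_ p q {{≢-nonZero q≢0}}

fromℕ : ℕ → ℚ
fromℕ m = + m / 1

-- Γ is a graph Laplacian plus the positive multiple (1/n)J of the all-ones matrix, so it is positive
-- semidefinite, and hence so is its (symmetric) inverse M.  Therefore every resistance
-- Ω_ij = (e_i - e_j)ᵀ M (e_i - e_j) is nonnegative, and summing the equations (Ωκ)_i = 1 gives
-- n = ∑_ij Ω_ij κ_j, which lies between K ∑_ij Ω_ij and K₂ ∑_ij Ω_ij.  Finally ∑_ij Ω_ij = 2 Kf because Ω is
-- symmetric with zero diagonal.
module Submission where

open import Defs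
open import Data.Nat using (ℕ)
open import Data.Fin using (Fin)
open import Data.Product using (_×_)
open import Data.Rational using (ℚ; 0ℚ; 1ℚ; _*_; _≤_; _<_; _/_)
open import Data.Integer using (+_)
open import Relation.Binary.PropositionalEquality using (_≡_)
import Data.Nat as N

open import Data.Nat using (zero; suc)
open import Data.Fin using (zero; suc; toℕ) renaming (_≟_ to _≟ᶠ_)
open import Data.Fin.Properties using (toℕ-injective; suc-injective)
open import Data.Rational using (_+_; _-_; -_; 1/_; positive; nonNegative; nonPositive; ≢-nonZero)
open import Data.Rational.Properties
  using (+-identityʳ; +-identityˡ; *-identityʳ; *-zeroʳ; *-zeroˡ; *-comm; *-assoc; +-comm;
         *-distribˡ-+; neg-distrib-+; ≤-refl; ≤-trans; ≤-reflexive; ≤-total; +-mono-≤; +-mono-<;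
         <-irrefl; ≤-<-trans; <-≤-trans; ≮⇒≥; *-monoˡ-≤-nonNeg; *-cancelʳ-≤-pos; *-inverseˡ;
         nonNegative⁻¹; positive⁻¹; nonPos*nonPos⇒nonPos; normalize-coprime; normalize-nonNeg;
         pos*pos⇒pos; module ≤-Reasoning)
  renaming (_≟_ to _≟ℚ_)
open import Data.Rational.Solver using (module +-*-Solver)
open import Relation.Binary.PropositionalEquality using (refl; sym; trans; cong; cong₂; subst; _≢_; module ≡-Reasoning)
open import Relation.Nullary using (yes; no; Dec)
open import Data.Empty using (⊥-elim)
open import Data.Product using (_,_; proj₁; proj₂; uncurry)
open import Data.Sum using (inj₁; inj₂)
open import Data.Bool using (true; false; T; if_then_else_)
open import Data.Unit using (tt)
open import Function using (_∘_)
open import Relation.Binary.Definitions using (tri<; tri≈; tri>)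
import Data.Nat.Properties as ℕ
import Data.Integer as ℤ
import Data.Nat.Coprimality as Coprimality

open +-*-Solver

*-nonNeg : ∀ {x y} → 0ℚ ≤ x → 0ℚ ≤ y → 0ℚ ≤ x * y
*-nonNeg {x} 0≤x 0≤y = ≤-trans (≤-reflexive (sym (*-zeroʳ x))) (*-monoˡ-≤-nonNeg x {{nonNegative 0≤x}} 0≤y)

square-nonNeg : ∀ x → 0ℚ ≤ x * x
square-nonNeg x with ≤-total 0ℚ x
... | inj₁ 0≤x = *-nonNeg 0≤x 0≤x
... | inj₂ x≤0 = nonNegative⁻¹ (x * x) {{nonPos*nonPos⇒nonPos x {{nonPositive x≤0}} x {{nonPositive x≤0}}}}

0≤x+x⇒0≤x : ∀ x → 0ℚ ≤ x + x → 0ℚ ≤ x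
0≤x+x⇒0≤x x 0≤x+x = ≮⇒≥ λ x<0 → <-irrefl refl (≤-<-trans 0≤x+x (+-mono-< {x} {0ℚ} {x} {0ℚ} x<0 x<0))

2*-pos : ∀ {k} → 0ℚ < k → 0ℚ < (+ 2 / 1) * k
2*-pos {k} 0<k = positive⁻¹ ((+ 2 / 1) * k) {{pos*pos⇒pos (+ 2 / 1) k {{positive 0<k}}}}

÷'-*-cancel : ∀ a {b} → b ≢ 0ℚ → (a ÷' b) * b ≡ a
÷'-*-cancel a {b} b≢0 with b ≟ℚ 0ℚ
... | yes b≡0 = ⊥-elim (b≢0 b≡0)
... | no b≢0′ = begin
  (a * (1/ b) {{≢-nonZero b≢0′}}) * b ≡⟨ *-assoc a _ b ⟩
  a * ((1/ b) {{≢-nonZero b≢0′}} * b) ≡⟨ cong (a *_) (*-inverseˡ b {{≢-nonZero b≢0′}}) ⟩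
  a * 1ℚ                               ≡⟨ *-identityʳ a ⟩
  a                                    ∎
  where open ≡-Reasoning

÷'-≤ : ∀ {a b x} → 0ℚ < b → a ≤ b * x → a ÷' b ≤ x
÷'-≤ {a} {b} {x} 0<b a≤bx = *-cancelʳ-≤-pos b {{positive 0<b}} (begin
  (a ÷' b) * b ≡⟨ ÷'-*-cancel a (λ b≡0 → <-irrefl (sym b≡0) 0<b) ⟩
  a            ≤⟨ a≤bx ⟩
  b * x        ≡⟨ *-comm b x ⟩
  x * b        ∎)
  where open ≤-Reasoning

≤-÷' : ∀ {a b x} → 0ℚ < b → b * x ≤ a → x ≤ a ÷' b
≤-÷' {a} {b} {x} 0<b bx≤a = *-cancelʳ-≤-pos b {{positive 0<b}} (begin
  x * b        ≡⟨ *-comm x b ⟩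
  b * x        ≤⟨ bx≤a ⟩
  a            ≡⟨ ÷'-*-cancel a (λ b≡0 → <-irrefl (sym b≡0) 0<b) ⟨
  (a ÷' b) * b ∎)
  where open ≤-Reasoning

∑-cong : ∀ {n} {f g : Fin n → ℚ} → (∀ i → f i ≡ g i) → ∑ f ≡ ∑ g
∑-cong {zero} f≡g = refl
∑-cong {suc n} f≡g = cong₂ _+_ (f≡g zero) (∑-cong (f≡g ∘ suc))

∑-zero : ∀ n → ∑ {n} (λ _ → 0ℚ) ≡ 0ℚ
∑-zero zero = refl
∑-zero (suc n) = cong (λ s → 0ℚ + s) (∑-zero n)

∑-+ : ∀ {n} (f g : Fin n → ℚ) → ∑ (λ i → f i + g i) ≡ ∑ f + ∑ g
∑-+ {zero} f g = refl
∑-+ {suc n} f g = begin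
  (f zero + g zero) + ∑ (λ i → f (suc i) + g (suc i))
    ≡⟨ cong (λ s → (f zero + g zero) + s) (∑-+ (f ∘ suc) (g ∘ suc)) ⟩
  (f zero + g zero) + (∑ (f ∘ suc) + ∑ (g ∘ suc))
    ≡⟨ solve 4 (λ a b c d → (a :+ b) :+ (c :+ d) := (a :+ c) :+ (b :+ d)) refl
         (f zero) (g zero) (∑ (f ∘ suc)) (∑ (g ∘ suc)) ⟩
  (f zero + ∑ (f ∘ suc)) + (g zero + ∑ (g ∘ suc)) ∎
  where open ≡-Reasoning

∑-*ˡ : ∀ {n} (c : ℚ) (f : Fin n → ℚ) → ∑ (λ i → c * f i) ≡ c * ∑ f
∑-*ˡ {zero} c f = sym (*-zeroʳ c)
∑-*ˡ {suc n} c f =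
  trans (cong (λ s → c * f zero + s) (∑-*ˡ c (f ∘ suc))) (sym (*-distribˡ-+ c (f zero) (∑ (f ∘ suc))))

∑-*ʳ : ∀ {n} (c : ℚ) (f : Fin n → ℚ) → ∑ (λ i → f i * c) ≡ ∑ f * c
∑-*ʳ c f = trans (∑-cong (λ i → *-comm (f i) c)) (trans (∑-*ˡ c f) (*-comm c (∑ f)))

∑-neg : ∀ {n} (f : Fin n → ℚ) → ∑ (λ i → - f i) ≡ - ∑ f
∑-neg {zero} f = refl
∑-neg {suc n} f =
  trans (cong (λ s → - f zero + s) (∑-neg (f ∘ suc))) (sym (neg-distrib-+ (f zero) (∑ (f ∘ suc))))

∑-- : ∀ {n} (f g : Fin n → ℚ) → ∑ (λ i → f i - g i) ≡ ∑ f - ∑ g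
∑-- f g = trans (∑-+ f (λ i → - g i)) (cong (λ s → ∑ f + s) (∑-neg g))

∑-swap : ∀ {m n} (f : Fin m → Fin n → ℚ) →
  ∑ (λ i → ∑ (λ j → f i j)) ≡ ∑ (λ j → ∑ (λ i → f i j))
∑-swap {zero} {n} f = sym (∑-zero n)
∑-swap {suc m} f =
  trans (cong (λ s → ∑ (f zero) + s) (∑-swap (f ∘ suc))) (sym (∑-+ (f zero) (λ j → ∑ (λ i → f (suc i) j))))

∑-mono : ∀ {n} {f g : Fin n → ℚ} → (∀ i → f i ≤ g i) → ∑ f ≤ ∑ g
∑-mono {zero} f≤g = ≤-refl
∑-mono {suc n} f≤g = +-mono-≤ (f≤g zero) (∑-mono (f≤g ∘ suc))

∑-nonNeg : ∀ {n} {f : Fin n → ℚ} → (∀ i → 0ℚ ≤ f i) → 0ℚ ≤ ∑ f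
∑-nonNeg {n} {f} f≥0 = subst (_≤ ∑ f) (∑-zero n) (∑-mono f≥0)

∑-1≡fromℕ : ∀ n → ∑ {n} (λ _ → 1ℚ) ≡ fromℕ n
∑-1≡fromℕ zero = refl
∑-1≡fromℕ (suc m) = trans (cong (λ s → 1ℚ + s) (∑-1≡fromℕ m)) (1+fromℕ m)
  where
  1+fromℕ : ∀ m → 1ℚ + fromℕ m ≡ fromℕ (suc m)
  1+fromℕ zero = refl
  1+fromℕ (suc k) =
    trans (cong (λ s → 1ℚ + s) (normalize-coprime (Coprimality.sym (Coprimality.1-coprimeTo (suc k)))))
          (cong (λ z → (+ 1 ℤ.+ + z) / 1) (ℕ.*-identityʳ (suc k)))

∑∑ : ∀ {n} → Matrix n → ℚ
∑∑ A = ∑ (λ i → ∑ (λ j → A i j))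

∑∑-mono : ∀ {n} {A B : Matrix n} → (∀ i j → A i j ≤ B i j) → ∑∑ A ≤ ∑∑ B
∑∑-mono A≤B = ∑-mono (λ i → ∑-mono (A≤B i))

∑∑-nonNeg : ∀ {n} {A : Matrix n} → (∀ i j → 0ℚ ≤ A i j) → 0ℚ ≤ ∑∑ A
∑∑-nonNeg A≥0 = ∑-nonNeg (λ i → ∑-nonNeg (A≥0 i))

∑∑-*ʳ : ∀ {n} (A : Matrix n) (c : ℚ) → ∑∑ (λ i j → A i j * c) ≡ ∑∑ A * c
∑∑-*ʳ A c = trans (∑-cong (λ i → ∑-*ʳ c (A i))) (∑-*ʳ c (λ i → ∑ (A i)))

∑∑-*-weight-mono : ∀ {n} {A : Matrix n} {a b : Fin n → ℚ} → (∀ i j → 0ℚ ≤ A i j) → (∀ j → a j ≤ b j) →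
  ∑∑ (λ i j → A i j * a j) ≤ ∑∑ (λ i j → A i j * b j)
∑∑-*-weight-mono {A = A} A≥0 a≤b = ∑∑-mono (λ i j → *-monoˡ-≤-nonNeg (A i j) {{nonNegative (A≥0 i j)}} (a≤b j))

δ-refl : ∀ {n} (i : Fin n) → δ i i ≡ 1ℚ
δ-refl i with i ≟ᶠ i
... | yes _ = refl
... | no i≢i = ⊥-elim (i≢i refl)

δ-≢ : ∀ {n} {i j : Fin n} → i ≢ j → δ i j ≡ 0ℚ
δ-≢ {i = i} {j} i≢j with i ≟ᶠ j
... | yes i≡j = ⊥-elim (i≢j i≡j)
... | no _ = refl

δ-sym : ∀ {n} (i j : Fin n) → δ i j ≡ δ j i
δ-sym i j = by-cases (i ≟ᶠ j)
  where
  by-cases : Dec (i ≡ j) → δ i j ≡ δ j i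
  by-cases (yes refl) = refl
  by-cases (no i≢j) = trans (δ-≢ i≢j) (sym (δ-≢ (i≢j ∘ sym)))

δ-suc : ∀ {n} (i j : Fin n) → δ (suc i) (suc j) ≡ δ i j
δ-suc i j = by-cases (i ≟ᶠ j)
  where
  by-cases : Dec (i ≡ j) → δ (suc i) (suc j) ≡ δ i j
  by-cases (yes refl) = trans (δ-refl (suc i)) (sym (δ-refl i))
  by-cases (no i≢j) = trans (δ-≢ (i≢j ∘ suc-injective)) (sym (δ-≢ i≢j))

∑-*δ : ∀ {n} (f : Fin n → ℚ) (i : Fin n) → ∑ (λ j → f j * δ i j) ≡ f i
∑-*δ {suc n} f zero = begin
  f zero * δ {suc n} zero zero + ∑ (λ j → f (suc j) * δ zero (suc j))
    ≡⟨ cong₂ _+_ (cong (f zero *_) (δ-refl {suc n} zero)) (∑-cong off-diagonal) ⟩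
  f zero * 1ℚ + ∑ {n} (λ _ → 0ℚ)
    ≡⟨ cong₂ _+_ (*-identityʳ (f zero)) (∑-zero n) ⟩
  f zero + 0ℚ
    ≡⟨ +-identityʳ (f zero) ⟩
  f zero ∎
  where
  open ≡-Reasoning
  off-diagonal : ∀ j → f (suc j) * δ zero (suc j) ≡ 0ℚ
  off-diagonal j = trans (cong (f (suc j) *_) (δ-≢ {i = zero} {j = suc j} λ ())) (*-zeroʳ (f (suc j)))
∑-*δ {suc n} f (suc i) = begin
  f zero * δ (suc i) zero + ∑ (λ j → f (suc j) * δ (suc i) (suc j))
    ≡⟨ cong₂ _+_ (trans (cong (f zero *_) (δ-≢ {i = suc i} {j = zero} λ ())) (*-zeroʳ (f zero)))
                 (∑-cong (λ j → cong (f (suc j) *_) (δ-suc i j))) ⟩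
  0ℚ + ∑ (λ j → f (suc j) * δ i j)
    ≡⟨ +-identityˡ _ ⟩
  ∑ (λ j → f (suc j) * δ i j)
    ≡⟨ ∑-*δ (f ∘ suc) i ⟩
  f (suc i) ∎
  where open ≡-Reasoning

∑-δ* : ∀ {n} (f : Fin n → ℚ) (i : Fin n) → ∑ (λ j → δ i j * f j) ≡ f i
∑-δ* f i = trans (∑-cong (λ j → *-comm (δ i j) (f j))) (∑-*δ f i)

Symmetric : ∀ {n} → Matrix n → Set
Symmetric A = ∀ i j → A i j ≡ A j i

_*ᵥ_ : ∀ {n} → Matrix n → (Fin n → ℚ) → Fin n → ℚ
(A *ᵥ u) i = ∑ (λ j → A i j * u j)

quadraticForm : ∀ {n} → Matrix n → (Fin n → ℚ) → ℚ
quadraticForm A u = ∑ (λ i → u i * (A *ᵥ u) i)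

PositiveSemidefinite : ∀ {n} → Matrix n → Set
PositiveSemidefinite A = ∀ u → 0ℚ ≤ quadraticForm A u

·-*ᵥ : ∀ {n} (A B : Matrix n) (u : Fin n → ℚ) i → ((A · B) *ᵥ u) i ≡ (A *ᵥ (B *ᵥ u)) i
·-*ᵥ A B u i = begin
  ∑ (λ k → ∑ (λ j → A i j * B j k) * u k)   ≡⟨ ∑-cong (λ k → sym (∑-*ʳ (u k) (λ j → A i j * B j k))) ⟩
  ∑ (λ k → ∑ (λ j → A i j * B j k * u k))   ≡⟨ ∑-swap (λ j k → A i j * B j k * u k) ⟨
  ∑ (λ j → ∑ (λ k → A i j * B j k * u k))   ≡⟨ ∑-cong (λ j → ∑-cong (λ k → *-assoc (A i j) (B j k) (u k))) ⟩
  ∑ (λ j → ∑ (λ k → A i j * (B j k * u k))) ≡⟨ ∑-cong (λ j → ∑-*ˡ (A i j) (λ k → B j k * u k)) ⟩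
  ∑ (λ j → A i j * (B *ᵥ u) j)              ∎
  where open ≡-Reasoning

inverse-symmetric : ∀ {n} {A M : Matrix n} → Symmetric A → (A · M) ≡ᴹ I → Symmetric M
inverse-symmetric {A = A} {M} A-sym AM≡I a b = begin
  M a b                                         ≡⟨ ∑-δ* (λ c → M c b) a ⟨
  ∑ (λ c → δ a c * M c b)                       ≡⟨ ∑-cong (λ c → cong (_* M c b) (trans (δ-sym a c) (sym (AM≡I c a)))) ⟩
  ∑ (λ c → ∑ (λ d → A c d * M d a) * M c b)     ≡⟨ ∑-cong (λ c → sym (∑-*ʳ (M c b) (λ d → A c d * M d a))) ⟩
  ∑ (λ c → ∑ (λ d → A c d * M d a * M c b))     ≡⟨ ∑-swap (λ c d → A c d * M d a * M c b) ⟩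
  ∑ (λ d → ∑ (λ c → A c d * M d a * M c b))     ≡⟨ ∑-cong (λ d → ∑-cong (λ c → rearrange c d)) ⟩
  ∑ (λ d → ∑ (λ c → M d a * (A d c * M c b)))   ≡⟨ ∑-cong (λ d → ∑-*ˡ (M d a) (λ c → A d c * M c b)) ⟩
  ∑ (λ d → M d a * (A · M) d b)                 ≡⟨ ∑-cong (λ d → cong (M d a *_) (trans (AM≡I d b) (δ-sym d b))) ⟩
  ∑ (λ d → M d a * δ b d)                       ≡⟨ ∑-*δ (λ d → M d a) b ⟩
  M b a                                         ∎
  where
  open ≡-Reasoning
  rearrange : ∀ c d → A c d * M d a * M c b ≡ M d a * (A d c * M c b)
  rearrange c d = trans (cong (λ x → x * M d a * M c b) (A-sym c d))
    (solve 3 (λ x y z → x :* y :* z := y :* (x :* z)) refl (A d c) (M d a) (M c b))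

inverse-positiveSemidefinite : ∀ {n} {A M : Matrix n} →
  (A · M) ≡ᴹ I → PositiveSemidefinite A → PositiveSemidefinite M
inverse-positiveSemidefinite {A = A} {M} AM≡I A-psd y =
  subst (0ℚ ≤_) (∑-cong swap-factors) (A-psd (M *ᵥ y))
  where
  A*ᵥM*ᵥy≡y : ∀ i → (A *ᵥ (M *ᵥ y)) i ≡ y i
  A*ᵥM*ᵥy≡y i = begin
    (A *ᵥ (M *ᵥ y)) i     ≡⟨ ·-*ᵥ A M y i ⟨
    ((A · M) *ᵥ y) i      ≡⟨ ∑-cong (λ j → cong (_* y j) (AM≡I i j)) ⟩
    ∑ (λ j → δ i j * y j) ≡⟨ ∑-δ* y i ⟩
    y i                   ∎
    where open ≡-Reasoning
  swap-factors : ∀ i → (M *ᵥ y) i * (A *ᵥ (M *ᵥ y)) i ≡ y i * (M *ᵥ y) i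
  swap-factors i = trans (cong ((M *ᵥ y) i *_) (A*ᵥM*ᵥy≡y i)) (*-comm ((M *ᵥ y) i) (y i))

Ω-symmetric : ∀ {n} {M : Matrix n} → Symmetric M → Symmetric (Ω M)
Ω-symmetric {M = M} M-sym i j =
  cong₂ (λ x y → x - (+ 2 / 1) * y) (+-comm (M i i) (M j j)) (M-sym i j)

Ω-diagonal : ∀ {n} (M : Matrix n) i → Ω M i i ≡ 0ℚ
Ω-diagonal M i = solve 1 (λ a → (a :+ a) :- con (+ 2 / 1) :* a := con 0ℚ) refl (M i i)

Ω-quadraticForm : ∀ {n} {M : Matrix n} → Symmetric M →
  ∀ i j → Ω M i j ≡ quadraticForm M (λ a → δ i a - δ j a)
Ω-quadraticForm {M = M} M-sym i j = sym (begin
  ∑ (λ a → e a * (M *ᵥ e) a)                   ≡⟨ ∑-cong (λ a → cong (e a *_) (M*ᵥe a)) ⟩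
  ∑ (λ a → (δ i a - δ j a) * f a)               ≡⟨ ∑-cong (λ a → distrib (δ i a) (δ j a) (f a)) ⟩
  ∑ (λ a → δ i a * f a - δ j a * f a)           ≡⟨ ∑-- (λ a → δ i a * f a) (λ a → δ j a * f a) ⟩
  ∑ (λ a → δ i a * f a) - ∑ (λ a → δ j a * f a) ≡⟨ cong₂ _-_ (∑-δ* f i) (∑-δ* f j) ⟩
  (M i i - M i j) - (M j i - M j j)             ≡⟨ cong (λ x → (M i i - M i j) - (x - M j j)) (M-sym j i) ⟩
  (M i i - M i j) - (M i j - M j j)             ≡⟨ solve 3 (λ a b c → (a :- b) :- (b :- c) := (a :+ c) :- con (+ 2 / 1) :* b)
                                                     refl (M i i) (M i j) (M j j) ⟩
  Ω M i j                                       ∎)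
  where
  open ≡-Reasoning
  e : Fin _ → ℚ
  e a = δ i a - δ j a
  f : Fin _ → ℚ
  f a = M a i - M a j
  distrib : ∀ x y z → (x - y) * z ≡ x * z - y * z
  distrib = solve 3 (λ x y z → (x :- y) :* z := x :* z :- y :* z) refl
  M*ᵥe : ∀ a → (M *ᵥ e) a ≡ f a
  M*ᵥe a = begin
    ∑ (λ b → M a b * (δ i b - δ j b))
      ≡⟨ ∑-cong (λ b → trans (*-comm (M a b) (e b)) (distrib (δ i b) (δ j b) (M a b))) ⟩
    ∑ (λ b → δ i b * M a b - δ j b * M a b)
      ≡⟨ ∑-- (λ b → δ i b * M a b) (λ b → δ j b * M a b) ⟩
    ∑ (λ b → δ i b * M a b) - ∑ (λ b → δ j b * M a b)
      ≡⟨ cong₂ _-_ (∑-δ* (M a) i) (∑-δ* (M a) j) ⟩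
    f a ∎

Ω-nonNeg : ∀ {n} {M : Matrix n} → Symmetric M → PositiveSemidefinite M → ∀ i j → 0ℚ ≤ Ω M i j
Ω-nonNeg M-sym M-psd i j = subst (0ℚ ≤_) (sym (Ω-quadraticForm M-sym i j)) (M-psd (λ a → δ i a - δ j a))

+-positiveSemidefinite : ∀ {n} {A B : Matrix n} → PositiveSemidefinite A → PositiveSemidefinite B →
  PositiveSemidefinite (λ i j → A i j + B i j)
+-positiveSemidefinite {A = A} {B} A-psd B-psd u =
  subst (0ℚ ≤_) (sym quadratic≡) (+-mono-≤ (A-psd u) (B-psd u))
  where
  split : ∀ i → u i * ∑ (λ j → (A i j + B i j) * u j) ≡ u i * (A *ᵥ u) i + u i * (B *ᵥ u) i
  split i = begin
    u i * ∑ (λ j → (A i j + B i j) * u j)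
      ≡⟨ cong (u i *_) (∑-cong (λ j → solve 3 (λ a b x → (a :+ b) :* x := a :* x :+ b :* x) refl
                                         (A i j) (B i j) (u j))) ⟩
    u i * ∑ (λ j → A i j * u j + B i j * u j)
      ≡⟨ cong (u i *_) (∑-+ (λ j → A i j * u j) (λ j → B i j * u j)) ⟩
    u i * ((A *ᵥ u) i + (B *ᵥ u) i)
      ≡⟨ *-distribˡ-+ (u i) _ _ ⟩
    u i * (A *ᵥ u) i + u i * (B *ᵥ u) i ∎
    where open ≡-Reasoning
  quadratic≡ : quadraticForm (λ i j → A i j + B i j) u ≡ quadraticForm A u + quadraticForm B u
  quadratic≡ = trans (∑-cong split) (∑-+ (λ i → u i * (A *ᵥ u) i) (λ i → u i * (B *ᵥ u) i))

constant-positiveSemidefinite : ∀ {n} {c : ℚ} → 0ℚ ≤ c → PositiveSemidefinite {n} (λ _ _ → c)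
constant-positiveSemidefinite {c = c} 0≤c u =
  subst (0ℚ ≤_) (sym quadratic≡) (*-nonNeg 0≤c (square-nonNeg (∑ u)))
  where
  open ≡-Reasoning
  quadratic≡ : ∑ (λ i → u i * ∑ (λ j → c * u j)) ≡ c * (∑ u * ∑ u)
  quadratic≡ = begin
    ∑ (λ i → u i * ∑ (λ j → c * u j)) ≡⟨ ∑-cong (λ i → cong (u i *_) (∑-*ˡ c u)) ⟩
    ∑ (λ i → u i * (c * ∑ u))         ≡⟨ ∑-*ʳ (c * ∑ u) u ⟩
    ∑ u * (c * ∑ u)                   ≡⟨ solve 2 (λ s k → s :* (k :* s) := k :* (s :* s)) refl (∑ u) c ⟩
    c * (∑ u * ∑ u)                   ∎

laplacian : ∀ {n} → Matrix n → Matrix n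
laplacian W i j = δ i j * ∑ (W i) - W i j

laplacian-symmetric : ∀ {n} {W : Matrix n} → Symmetric W → Symmetric (laplacian W)
laplacian-symmetric {W = W} W-sym i j = by-cases (i ≟ᶠ j)
  where
  by-cases : Dec (i ≡ j) → laplacian W i j ≡ laplacian W j i
  by-cases (yes refl) = refl
  by-cases (no i≢j) = cong₂ _-_ (trans (off-diagonal i≢j) (sym (off-diagonal (i≢j ∘ sym)))) (W-sym i j)
    where
    off-diagonal : ∀ {a b} → a ≢ b → δ a b * ∑ (W a) ≡ 0ℚ
    off-diagonal {a} a≢b = trans (cong (_* ∑ (W a)) (δ-≢ a≢b)) (*-zeroˡ (∑ (W a)))

laplacian-*ᵥ : ∀ {n} (W : Matrix n) u i → (laplacian W *ᵥ u) i ≡ ∑ (λ j → W i j * (u i - u j))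
laplacian-*ᵥ W u i = begin
  ∑ (λ j → (δ i j * ∑ (W i) - W i j) * u j)
    ≡⟨ ∑-cong (λ j → solve 4 (λ e d w x → (e :* d :- w) :* x := e :* (d :* x) :- w :* x) refl
                       (δ i j) (∑ (W i)) (W i j) (u j)) ⟩
  ∑ (λ j → δ i j * (∑ (W i) * u j) - W i j * u j)
    ≡⟨ ∑-- (λ j → δ i j * (∑ (W i) * u j)) (λ j → W i j * u j) ⟩
  ∑ (λ j → δ i j * (∑ (W i) * u j)) - ∑ (λ j → W i j * u j)
    ≡⟨ cong (_- ∑ (λ j → W i j * u j)) (trans (∑-δ* (λ j → ∑ (W i) * u j) i) (sym (∑-*ʳ (u i) (W i)))) ⟩
  ∑ (λ j → W i j * u i) - ∑ (λ j → W i j * u j)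
    ≡⟨ sym (∑-- (λ j → W i j * u i) (λ j → W i j * u j)) ⟩
  ∑ (λ j → W i j * u i - W i j * u j)
    ≡⟨ ∑-cong (λ j → solve 3 (λ w x y → w :* x :- w :* y := w :* (x :- y)) refl (W i j) (u i) (u j)) ⟩
  ∑ (λ j → W i j * (u i - u j)) ∎
  where open ≡-Reasoning

-- Symmetrising the double sum turns each term into W_ij (u_i - u_j)².
laplacian-positiveSemidefinite : ∀ {n} {W : Matrix n} → Symmetric W → (∀ i j → 0ℚ ≤ W i j) →
  PositiveSemidefinite (laplacian W)
laplacian-positiveSemidefinite {W = W} W-sym W≥0 u =
  0≤x+x⇒0≤x (quadraticForm (laplacian W) u) (subst (0ℚ ≤_) (sym doubled) (∑∑-nonNeg terms≥0))
  where
  open ≡-Reasoning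
  P : Matrix _
  P i j = W i j * (u i * (u i - u j))
  quadratic≡ : quadraticForm (laplacian W) u ≡ ∑∑ P
  quadratic≡ = ∑-cong (λ i → begin
    u i * (laplacian W *ᵥ u) i             ≡⟨ cong (u i *_) (laplacian-*ᵥ W u i) ⟩
    u i * ∑ (λ j → W i j * (u i - u j))    ≡⟨ sym (∑-*ˡ (u i) (λ j → W i j * (u i - u j))) ⟩
    ∑ (λ j → u i * (W i j * (u i - u j)))  ≡⟨ ∑-cong (λ j → solve 3 (λ x w d → x :* (w :* d) := w :* (x :* d)) refl
                                                                (u i) (W i j) (u i - u j)) ⟩
    ∑ (P i)                                ∎)
  pair : ∀ i j → P i j + P j i ≡ W i j * ((u i - u j) * (u i - u j))
  pair i j = trans (cong (λ w → P i j + w * (u j * (u j - u i))) (W-sym j i))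
    (solve 3 (λ w x y → w :* (x :* (x :- y)) :+ w :* (y :* (y :- x)) := w :* ((x :- y) :* (x :- y))) refl
       (W i j) (u i) (u j))
  terms≥0 : ∀ i j → 0ℚ ≤ W i j * ((u i - u j) * (u i - u j))
  terms≥0 i j = *-nonNeg (W≥0 i j) (square-nonNeg (u i - u j))
  doubled : quadraticForm (laplacian W) u + quadraticForm (laplacian W) u ≡
            ∑∑ (λ i j → W i j * ((u i - u j) * (u i - u j)))
  doubled = begin
    quadraticForm (laplacian W) u + quadraticForm (laplacian W) u ≡⟨ cong₂ _+_ quadratic≡ (trans quadratic≡ (∑-swap P)) ⟩
    ∑∑ P + ∑ (λ i → ∑ (λ j → P j i))                              ≡⟨ sym (∑-+ (λ i → ∑ (P i)) (λ i → ∑ (λ j → P j i))) ⟩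
    ∑ (λ i → ∑ (P i) + ∑ (λ j → P j i))                           ≡⟨ ∑-cong (λ i → sym (∑-+ (P i) (λ j → P j i))) ⟩
    ∑∑ (λ i j → P i j + P j i)                                    ≡⟨ ∑-cong (λ i → ∑-cong (pair i)) ⟩
    ∑∑ (λ i j → W i j * ((u i - u j) * (u i - u j)))              ∎

b2q-nonNeg : ∀ b → 0ℚ ≤ b2q b
b2q-nonNeg true = nonNegative⁻¹ 1ℚ
b2q-nonNeg false = ≤-refl

inv-nonNeg : ∀ n → 0ℚ ≤ inv n
inv-nonNeg zero = ≤-refl
inv-nonNeg (suc k) = nonNegative⁻¹ (inv (suc k)) {{normalize-nonNeg 1 (suc k)}}

Adj-symmetric : ∀ {n} (G : SimpleGraph n) → Symmetric (Adj G)
Adj-symmetric G i j = cong b2q (adj-sym G i j)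

-- Γ G i j unfolds to laplacian (Adj G) i j + inv n.
Γ-symmetric : ∀ {n} (G : SimpleGraph n) → Symmetric (Γ G)
Γ-symmetric {n} G i j = cong (_+ inv n) (laplacian-symmetric (Adj-symmetric G) i j)

Γ-positiveSemidefinite : ∀ {n} (G : SimpleGraph n) → PositiveSemidefinite (Γ G)
Γ-positiveSemidefinite {n} G = +-positiveSemidefinite {A = laplacian (Adj G)} {B = λ _ _ → inv n}
  (laplacian-positiveSemidefinite (Adj-symmetric G) (λ i j → b2q-nonNeg (adj G i j)))
  (constant-positiveSemidefinite (inv-nonNeg n))

-- Kf A unfolds to ∑∑ (strictUpper A).
strictUpper : ∀ {n} → Matrix n → Matrix n
strictUpper A i j = if toℕ i N.<ᵇ toℕ j then A i j else 0ℚ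

strictUpper-split : ∀ {n} {A : Matrix n} → Symmetric A → (∀ i → A i i ≡ 0ℚ) →
  ∀ i j → A i j ≡ strictUpper A i j + strictUpper A j i
strictUpper-split {A = A} A-sym A-diag i j with toℕ i N.<ᵇ toℕ j in i<ᵇj | toℕ j N.<ᵇ toℕ i in j<ᵇi
... | true | true = ⊥-elim (ℕ.<-asym (<ᵇ-true (toℕ i) (toℕ j) i<ᵇj) (<ᵇ-true (toℕ j) (toℕ i) j<ᵇi))
  where
  <ᵇ-true : ∀ m n → (m N.<ᵇ n) ≡ true → m N.< n
  <ᵇ-true m n m<ᵇn = ℕ.<ᵇ⇒< m n (subst T (sym m<ᵇn) tt)
... | true | false = sym (+-identityʳ (A i j))
... | false | true = trans (A-sym i j) (sym (+-identityˡ (A j i)))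
... | false | false with ℕ.<-cmp (toℕ i) (toℕ j)
...   | tri< i<j _ _ = ⊥-elim (subst T i<ᵇj (ℕ.<⇒<ᵇ i<j))
...   | tri> _ _ j<i = ⊥-elim (subst T j<ᵇi (ℕ.<⇒<ᵇ j<i))
...   | tri≈ _ i≡j _ rewrite toℕ-injective i≡j = A-diag j

∑∑≡Kf+Kf : ∀ {n} {A : Matrix n} → Symmetric A → (∀ i → A i i ≡ 0ℚ) → ∑∑ A ≡ Kf A + Kf A
∑∑≡Kf+Kf {A = A} A-sym A-diag = begin
  ∑∑ A                                           ≡⟨ ∑-cong (λ i → ∑-cong (strictUpper-split A-sym A-diag i)) ⟩
  ∑∑ (λ i j → U i j + U j i)                     ≡⟨ ∑-cong (λ i → ∑-+ (U i) (λ j → U j i)) ⟩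
  ∑ (λ i → ∑ (U i) + ∑ (λ j → U j i))            ≡⟨ ∑-+ (λ i → ∑ (U i)) (λ i → ∑ (λ j → U j i)) ⟩
  ∑∑ U + ∑ (λ i → ∑ (λ j → U j i))               ≡⟨ cong (λ s → ∑∑ U + s) (∑-swap U) ⟨
  Kf A + Kf A                                    ∎
  where
  open ≡-Reasoning
  U : Matrix _
  U = strictUpper A

first-vertex : ∀ {n} → 2 N.≤ n → Fin n
first-vertex (N.s≤s _) = zero

proposition1 : (n : ℕ) → 2 N.≤ n → (G : SimpleGraph n) → Connected G →
    (M : Matrix n) → (Γ G · M) ≡ᴹ I → (M · Γ G) ≡ᴹ I →
    (κ : Fin n → ℚ) → (∀ i → ∑ (λ j → Ω M i j * κ j) ≡ 1ℚ) →
    (K K₂ : ℚ) → 0ℚ < K → (∀ i → K ≤ κ i × κ i ≤ K₂) →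
    (fromℕ n ÷' ((+ 2 / 1) * K₂) ≤ Kf (Ω M)) × (Kf (Ω M) ≤ fromℕ n ÷' ((+ 2 / 1) * K))
proposition1 n n≥2 G _ M ΓM≡I _ κ Ωκ≡1 K K₂ 0<K K≤κ≤K₂ = lower , upper
  where
  open ≤-Reasoning
  M-sym : Symmetric M
  M-sym = inverse-symmetric {A = Γ G} (Γ-symmetric G) ΓM≡I
  Ω≥0 : ∀ i j → 0ℚ ≤ Ω M i j
  Ω≥0 = Ω-nonNeg M-sym (inverse-positiveSemidefinite {A = Γ G} ΓM≡I (Γ-positiveSemidefinite G))
  n≡∑∑Ωκ : fromℕ n ≡ ∑∑ (λ i j → Ω M i j * κ j)
  n≡∑∑Ωκ = trans (sym (∑-1≡fromℕ n)) (∑-cong (sym ∘ Ωκ≡1))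
  ∑∑Ω*c : ∀ c → ∑∑ (λ i j → Ω M i j * c) ≡ (+ 2 / 1) * c * Kf (Ω M)
  ∑∑Ω*c c = trans (∑∑-*ʳ (Ω M) c) (trans (cong (_* c) (∑∑≡Kf+Kf (Ω-symmetric M-sym) (Ω-diagonal M)))
    (solve 2 (λ x y → (x :+ x) :* y := con (+ 2 / 1) :* y :* x) refl (Kf (Ω M)) c))
  0<K₂ : 0ℚ < K₂
  0<K₂ = <-≤-trans 0<K (uncurry ≤-trans (K≤κ≤K₂ (first-vertex n≥2)))
  lower : fromℕ n ÷' ((+ 2 / 1) * K₂) ≤ Kf (Ω M)
  lower = ÷'-≤ (2*-pos 0<K₂) (begin
    fromℕ n                         ≡⟨ n≡∑∑Ωκ ⟩
    ∑∑ (λ i j → Ω M i j * κ j)      ≤⟨ ∑∑-*-weight-mono Ω≥0 (proj₂ ∘ K≤κ≤K₂) ⟩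
    ∑∑ (λ i j → Ω M i j * K₂)       ≡⟨ ∑∑Ω*c K₂ ⟩
    (+ 2 / 1) * K₂ * Kf (Ω M)       ∎)
  upper : Kf (Ω M) ≤ fromℕ n ÷' ((+ 2 / 1) * K)
  upper = ≤-÷' (2*-pos 0<K) (begin
    (+ 2 / 1) * K * Kf (Ω M)        ≡⟨ ∑∑Ω*c K ⟨
    ∑∑ (λ i j → Ω M i j * K)        ≤⟨ ∑∑-*-weight-mono Ω≥0 (proj₁ ∘ K≤κ≤K₂) ⟩
    ∑∑ (λ i j → Ω M i j * κ j)      ≡⟨ n≡∑∑Ωκ ⟨
    fromℕ n                         ∎)
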